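{- Let $k\geq 1$ be an integer and let $G$ be a connected graph with at least 3 vertices. Then for every leaf vertex $v$ of $G$ there exists a $\gamma_{[kR]}$-function $f$ of $G$ with $f(v)\in\{0,k\}$.
   Context: All graphs are finite and simple; a leaf is a vertex of degree 1. For $f\colon V(G)\to\mathbb{Z}_{\ge 0}$ and $S\subseteq V(G)$, $f(S)=\sum_{v\in S}f(v)$, and $AN(v)=\{w\in N(v): f(w)\ge 1\}$. A $[k]$-Roman dominating function ($[k]$-RDF) of $G$ is a function $f\colon V(G)\to\{0,1,\ldots,k+1\}$ such that $f(N[v])\ge k+|AN(v)|$ for every vertex $v$ with $f(v)<k$; its weight is $f(V(G))$. The $[k]$-Roman domination number $\gamma_{[kR]}(G)$ is the minimum weight of a $[k]$-RDF of $G$, and a $\gamma_{[kR]}$-function is a $[k]$-RDF of weight $\gamma_{[kR]}(G)$. -}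

module Defs where

open import Data.Nat using (ℕ; zero; suc; _+_; _≤_; _<_)
open import Data.Bool using (Bool; true; false; if_then_else_; _∧_; _∨_)
open import Data.Fin using (Fin)
open import Data.Fin.Properties using (_≟_)
open import Data.Vec.Functional using (Vector; foldr)
open import Relation.Nullary.Decidable using (⌊_⌋)
open import Relation.Binary.PropositionalEquality using (_≡_)
open import Data.Product using (Σ; _×_)
open import Data.Sum using (_⊎_)

record Graph (n : ℕ) : Set where
  field
    adj    : Fin n → Fin n → Bool
    sym    : ∀ u v → adj u v ≡ adj v u
    irrefl : ∀ v → adj v v ≡ false
open Graph public

Σᵥ : ∀ {n} → (Fin n → ℕ) → ℕ
Σᵥ g = foldr _+_ 0 g

[_] : Bool → ℕ
[ true ]  = 1
[ false ] = 0

isPos : ℕ → Bool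
isPos zero    = false
isPos (suc _) = true

deg : ∀ {n} → Graph n → Fin n → ℕ
deg G v = Σᵥ (λ w → [ adj G v w ])

isLeaf : ∀ {n} → Graph n → Fin n → Set
isLeaf G v = deg G v ≡ 1

data Walk {n} (G : Graph n) : Fin n → Fin n → Set where
  here : ∀ {v} → Walk G v v
  step : ∀ {u v w} → adj G u v ≡ true → Walk G v w → Walk G u w

Connected : ∀ {n} → Graph n → Set
Connected G = ∀ u w → Walk G u w

fN[_] : ∀ {n} → Graph n → (Fin n → ℕ) → Fin n → ℕ
fN[ G ] f v = Σᵥ (λ w → if adj G v w ∨ ⌊ w ≟ v ⌋ then f w else 0)

|AN| : ∀ {n} → Graph n → (Fin n → ℕ) → Fin n → ℕ
|AN| G f v = Σᵥ (λ w → [ adj G v w ∧ isPos (f w) ])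

weight : ∀ {n} → (Fin n → ℕ) → ℕ
weight f = Σᵥ f

IsKRDF : ∀ {n} → ℕ → Graph n → (Fin n → ℕ) → Set
IsKRDF k G f =
  (∀ v → f v ≤ suc k) ×
  (∀ v → f v < k → k + |AN| G f v ≤ fN[ G ] f v)

IsGammaKR : ∀ {n} → ℕ → Graph n → (Fin n → ℕ) → Set
IsGammaKR k G f = IsKRDF k G f × (∀ g → IsKRDF k G g → weight f ≤ weight g)

{-# OPTIONS --safe #-}
-- Let u be the support vertex of the leaf v and f a γ-function with f(v) ≠ k.  If
-- f(v) < k the condition at v reads k + [f(u) > 0] ≤ f(u) + f(v), so in every case
-- f(u) + f(v) ≥ k + 1.  Moving this mass onto u, i.e. setting f(v) = 0 and
-- f(u) = k + 1, does not increase the weight and still gives a [k]-RDF: v is now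
-- defended by u alone, and another vertex w never sees v, while the rise of f(u) to
-- k + 1 pays for u possibly becoming a new active neighbour of w.
-- γ-functions exist at all because [k]-RDFs take values in {0, …, k + 1}, so a
-- minimum can be found by exhaustive search.
module Submission where

open import Defs hiding (sym)
open import Data.Bool using (true; false; _∧_; _∨_; if_then_else_)
open import Data.Bool.Properties using (¬-not)
open import Data.Fin using (Fin; zero; suc; toℕ; fromℕ; fromℕ<; punchIn; punchOut)
open import Data.Fin.Properties
  using (_≟_; any?; all?; ¬∀⟶∃¬; toℕ-fromℕ; toℕ-fromℕ<;
         punchInᵢ≢i; punchIn-punchOut; punchIn-injective)
import Data.Nat as ℕ
open import Data.Nat using (ℕ; zero; suc; _+_; _≤_; _<_; z≤n; s≤s; _≤?_; _<?_)
open import Data.Nat.Properties hiding (_≟_)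
open import Data.Product using (Σ; ∃; _×_; _,_; proj₁; proj₂)
open import Data.Sum using (_⊎_; inj₁; inj₂)
open import Data.Vec.Functional using (Vector; _∷_; head; tail; removeAt; updateAt)
open import Data.Vec.Functional.Properties using (updateAt-updates; updateAt-minimal)
open import Function using (_∘_; const)
open import Relation.Binary.Core using (_Preserves_⟶_)
open import Relation.Binary.Definitions using (_Respects_; tri<; tri≈; tri>)
open import Relation.Binary.PropositionalEquality hiding ([_])
open import Relation.Nullary using (Dec; yes; no; contradiction)
open import Relation.Nullary.Decidable using (⌊_⌋; map′; _×-dec_; _→-dec_)
open import Relation.Unary using (Decidable)

open import Algebra.Properties.CommutativeMonoid.Sum +-0-commutativeMonoid
  using (sum; sum-cong-≗; sum-replicate-zero; sum-remove; ∑-distrib-+)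
open import Algebra.Properties.CommutativeSemigroup +-commutativeSemigroup
  using (xy∙z≈zy∙x; xy∙z≈xz∙y)

sum-mono-≤ : ∀ {n} {f g : Vector ℕ n} → (∀ i → f i ≤ g i) → sum f ≤ sum g
sum-mono-≤ {zero}  f≤g = z≤n
sum-mono-≤ {suc n} f≤g = +-mono-≤ (f≤g zero) (sum-mono-≤ (f≤g ∘ suc))

sum-zero : ∀ {n} {f : Vector ℕ n} → (∀ i → f i ≡ 0) → sum f ≡ 0
sum-zero {n} f≗0 = trans (sum-cong-≗ f≗0) (sum-replicate-zero n)

nonzero-entry : ∀ {n} (f : Vector ℕ n) → sum f ≢ 0 → ∃ λ i → f i ≢ 0
nonzero-entry {n} f sum≢0 = ¬∀⟶∃¬ n (λ i → f i ≡ 0) (λ i → f i ℕ.≟ 0) (sum≢0 ∘ sum-zero)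

entry≤sum : ∀ {n} (f : Vector ℕ n) i → f i ≤ sum f
entry≤sum {suc n} f i = ≤-trans (m≤m+n (f i) _) (≤-reflexive (sym (sum-remove {i = i} f)))

entry+entry≤sum : ∀ {n} (f : Vector ℕ n) {i j} → i ≢ j → f i + f j ≤ sum f
entry+entry≤sum {suc n} f {i} {j} i≢j = begin
  f i + f j                          ≡⟨ cong (λ l → f i + f l) (punchIn-punchOut i≢j) ⟨
  f i + removeAt f i (punchOut i≢j)  ≤⟨ +-monoʳ-≤ (f i) (entry≤sum (removeAt f i) _) ⟩
  f i + sum (removeAt f i)           ≡⟨ sum-remove f ⟨
  sum f                              ∎
  where open ≤-Reasoning

sum-supported-at : ∀ {n} (f : Vector ℕ n) {i} → (∀ j → j ≢ i → f j ≡ 0) → sum f ≡ f i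
sum-supported-at {suc n} f {i} off-i = begin
  sum f                     ≡⟨ sum-remove f ⟩
  f i + sum (removeAt f i)  ≡⟨ cong (f i +_) (sum-zero (λ j → off-i (punchIn i j) (punchInᵢ≢i i j))) ⟩
  f i + 0                   ≡⟨ +-identityʳ (f i) ⟩
  f i                       ∎
  where open ≡-Reasoning

sum-supported-at₂ : ∀ {n} (f : Vector ℕ n) {i j} → i ≢ j →
                    (∀ l → l ≢ i → l ≢ j → f l ≡ 0) → sum f ≡ f i + f j
sum-supported-at₂ {suc n} f {i} {j} i≢j off-ij = begin
  sum f                               ≡⟨ sum-remove f ⟩
  f i + sum (removeAt f i)            ≡⟨ cong (f i +_) (sum-supported-at (removeAt f i) off-j′) ⟩
  f i + f (punchIn i (punchOut i≢j))  ≡⟨ cong (λ l → f i + f l) (punchIn-punchOut i≢j) ⟩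
  f i + f j                           ∎
  where
  open ≡-Reasoning
  off-j′ : ∀ l → l ≢ punchOut i≢j → f (punchIn i l) ≡ 0
  off-j′ l l≢j′ = off-ij (punchIn i l) (punchInᵢ≢i i l)
    (λ eq → l≢j′ (punchIn-injective i l _ (trans eq (sym (punchIn-punchOut i≢j)))))

sum-updateAt : ∀ {n} (f : Vector ℕ n) i (h : ℕ → ℕ) →
               sum (updateAt f i h) + f i ≡ sum f + h (f i)
sum-updateAt {suc n} f i h = begin
  sum f′ + f i                         ≡⟨ cong (_+ f i) (sum-remove f′) ⟩
  f′ i + sum (removeAt f′ i) + f i     ≡⟨ cong₂ (λ a r → a + r + f i) (updateAt-updates i f)
                                                (sum-cong-≗ untouched) ⟩
  h (f i) + sum (removeAt f i) + f i   ≡⟨ xy∙z≈zy∙x (h (f i)) _ (f i) ⟩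
  f i + sum (removeAt f i) + h (f i)   ≡⟨ cong (_+ h (f i)) (sum-remove f) ⟨
  sum f + h (f i)                      ∎
  where
  open ≡-Reasoning
  f′ : Vector ℕ (suc n)
  f′ = updateAt f i h
  untouched : ∀ j → f′ (punchIn i j) ≡ f (punchIn i j)
  untouched j = updateAt-minimal (punchIn i j) i f (punchInᵢ≢i i j)

module _ {m : ℕ} where

  any-function? : ∀ {n} {P : (Fin n → Fin m) → Set} →
                  P Respects _≗_ → Decidable P → Dec (∃ P)
  any-function? {zero} resp P? = map′ (λ p → _ , p) (λ (f , p) → resp (λ ()) p) (P? (λ ()))
  any-function? {suc n} {P} resp P? =
    map′ (λ (t , a , p) → a ∷ t , p)
         (λ (f , p) → tail f , head f , resp head∷tail p)
         (any-function? resp-tail (λ t → any? (λ a → P? (a ∷ t))))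
    where
    head∷tail : ∀ {f : Fin (suc n) → Fin m} → f ≗ head f ∷ tail f
    head∷tail zero    = refl
    head∷tail (suc i) = refl
    resp-tail : (λ t → ∃ λ a → P (a ∷ t)) Respects _≗_
    resp-tail t≗t′ (a , p) = a , resp (λ { zero → refl ; (suc i) → t≗t′ i }) p

  minimal-witness : ∀ {n} {P : (Fin n → Fin m) → Set} →
                    P Respects _≗_ → Decidable P →
                    (μ : (Fin n → Fin m) → ℕ) → μ Preserves _≗_ ⟶ _≡_ →
                    ∃ P → ∃ λ φ → P φ × (∀ ψ → P ψ → μ φ ≤ μ ψ)
  minimal-witness {P = P} resp P? μ μ-cong (φ , p) = descend (suc (μ φ)) φ ≤-refl p
    where
    smaller? : ∀ φ → Dec (∃ λ ψ → P ψ × μ ψ < μ φ)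
    smaller? φ = any-function? (λ ψ≗ψ′ (p , lt) → resp ψ≗ψ′ p , subst (_< μ φ) (μ-cong ψ≗ψ′) lt)
                               (λ ψ → P? ψ ×-dec μ ψ <? μ φ)
    descend : ∀ b φ → μ φ < b → P φ → ∃ λ φ → P φ × (∀ ψ → P ψ → μ φ ≤ μ ψ)
    descend (suc b) φ μφ<b p with smaller? φ
    ... | yes (ψ , q , μψ<μφ) = descend b ψ (<-≤-trans μψ<μφ (≤-pred μφ<b)) q
    ... | no ∄smaller = φ , p , λ ψ q → ≮⇒≥ (λ μψ<μφ → ∄smaller (ψ , q , μψ<μφ))

module _ (k : ℕ) {n : ℕ} (G : Graph n) where

  isKRDF-resp-≗ : IsKRDF k G Respects _≗_
  isKRDF-resp-≗ {f} {g} f≗g (f-bounded , f-cond) = g-bounded , g-cond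
    where
    g-bounded : ∀ w → g w ≤ suc k
    g-bounded w = subst (_≤ suc k) (f≗g w) (f-bounded w)
    g-cond : ∀ w → g w < k → k + |AN| G g w ≤ fN[ G ] g w
    g-cond w gw<k = subst₂ (λ a b → k + a ≤ b)
      (sum-cong-≗ (λ x → cong (λ a → [ adj G w x ∧ isPos a ]) (f≗g x)))
      (sum-cong-≗ (λ x → cong (λ a → if adj G w x ∨ ⌊ x ≟ w ⌋ then a else 0) (f≗g x)))
      (f-cond w (subst (_< k) (sym (f≗g w)) gw<k))

  isKRDF? : Decidable (IsKRDF k G)
  isKRDF? f = all? (λ w → f w ≤? suc k)
        ×-dec all? (λ w → f w <? k →-dec k + |AN| G f w ≤? fN[ G ] f w)

  constant-isKRDF : IsKRDF k G (const (suc k))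
  constant-isKRDF = (λ _ → ≤-refl) , (λ _ k+1<k → contradiction k+1<k (<-asym (n<1+n k)))

  γ-function-exists : ∃ (IsGammaKR k G)
  γ-function-exists =
    let φ , φ-krdf , φ-min = minimal-witness (isKRDF-resp-≗ ∘ decode-cong) (isKRDF? ∘ decode)
                               (weight ∘ decode) (sum-cong-≗ ∘ decode-cong)
                               (const (fromℕ (suc k)) , top-isKRDF)
    in decode φ , φ-krdf , λ g g-krdf →
         subst (weight (decode φ) ≤_) (sum-cong-≗ (decode-encode g-krdf))
               (φ-min (encode g-krdf) (isKRDF-resp-≗ (sym ∘ decode-encode g-krdf) g-krdf))
    where
    decode : (Fin n → Fin (2 + k)) → Fin n → ℕ
    decode φ = toℕ ∘ φ
    decode-cong : ∀ {φ ψ} → φ ≗ ψ → decode φ ≗ decode ψ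
    decode-cong φ≗ψ = cong toℕ ∘ φ≗ψ
    top-isKRDF : IsKRDF k G (decode (const (fromℕ (suc k))))
    top-isKRDF = isKRDF-resp-≗ (λ _ → sym (toℕ-fromℕ (suc k))) constant-isKRDF
    encode : ∀ {g} → IsKRDF k G g → Fin n → Fin (2 + k)
    encode (g-bounded , _) w = fromℕ< (s≤s (g-bounded w))
    decode-encode : ∀ {g} (g-krdf : IsKRDF k G g) → decode (encode g-krdf) ≗ g
    decode-encode _ w = toℕ-fromℕ< _

+-transfer-≤ : ∀ {k a a′ s s′} → a′ + s ≤ a + s′ → k + a ≤ s → k + a′ ≤ s′
+-transfer-≤ {k} {a} {a′} {s} {s′} a′+s≤a+s′ k+a≤s = +-cancelʳ-≤ s (k + a′) s′ (begin
  k + a′ + s    ≡⟨ +-assoc k a′ s ⟩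
  k + (a′ + s)  ≤⟨ +-monoʳ-≤ k a′+s≤a+s′ ⟩
  k + (a + s′)  ≡⟨ +-assoc k a s′ ⟨
  k + a + s′    ≤⟨ +-monoˡ-≤ s′ k+a≤s ⟩
  s + s′        ≡⟨ +-comm s s′ ⟩
  s′ + s        ∎)
  where open ≤-Reasoning

neighbourhood-exchange : ∀ {n k} (G : Graph n) {f g : Fin n → ℕ} w → f w ≤ g w →
  (∀ x → adj G w x ≡ true → [ isPos (g x) ] + f x ≤ [ isPos (f x) ] + g x) →
  k + |AN| G f w ≤ fN[ G ] f w → k + |AN| G g w ≤ fN[ G ] g w
neighbourhood-exchange {k = k} G {f} {g} w fw≤gw exchange =
  +-transfer-≤ {k} {|AN| G f w} {|AN| G g w} {fN[ G ] f w} {fN[ G ] g w}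
  (subst₂ _≤_ (∑-distrib-+ (active g) (closed f)) (∑-distrib-+ (active f) (closed g))
               (sum-mono-≤ termwise))
  where
  active closed : (Fin _ → ℕ) → Fin _ → ℕ
  active h x = [ adj G w x ∧ isPos (h x) ]
  closed h x = if adj G w x ∨ ⌊ x ≟ w ⌋ then h x else 0
  termwise : ∀ x → [ adj G w x ∧ isPos (g x) ] + (if adj G w x ∨ ⌊ x ≟ w ⌋ then f x else 0)
                 ≤ [ adj G w x ∧ isPos (f x) ] + (if adj G w x ∨ ⌊ x ≟ w ⌋ then g x else 0)
  termwise x with adj G w x in wx
  ... | true  = exchange x wx
  ... | false with x ≟ w
  ...   | yes refl = fw≤gw
  ...   | no  _    = z≤n

[]≢0⇒true : ∀ {b} → [ b ] ≢ 0 → b ≡ true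
[]≢0⇒true {true}  _     = refl
[]≢0⇒true {false} [b]≢0 = contradiction refl [b]≢0

module Leaf {n : ℕ} (G : Graph n) {v : Fin n} (leaf : isLeaf G v) where

  private
    neighbour : ∃ λ u → [ adj G v u ] ≢ 0
    neighbour = nonzero-entry (λ x → [ adj G v x ])
                              (λ deg≡0 → contradiction (trans (sym leaf) deg≡0) λ ())

  support : Fin n
  support = proj₁ neighbour

  support-adj : adj G v support ≡ true
  support-adj = []≢0⇒true (proj₂ neighbour)

  neighbour≡support : ∀ {w} → adj G v w ≡ true → w ≡ support
  neighbour≡support {w} vw with w ≟ support
  ... | yes w≡u = w≡u
  ... | no  w≢u = contradiction
    (subst₂ (λ a b → [ a ] + [ b ] ≤ 1) vw support-adj
            (≤-trans (entry+entry≤sum (λ x → [ adj G v x ]) w≢u) (≤-reflexive leaf)))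
    (<-irrefl refl)

  adjacent-to-leaf⇒support : ∀ {w} → adj G w v ≡ true → w ≡ support
  adjacent-to-leaf⇒support {w} wv = neighbour≡support (trans (Graph.sym G v w) wv)

  support≢leaf : support ≢ v
  support≢leaf u≡v = contradiction
    (trans (sym (subst (λ x → adj G v x ≡ true) u≡v support-adj)) (irrefl G v)) λ ()

  non-neighbour : ∀ {w} → w ≢ support → adj G v w ≡ false
  non-neighbour w≢u = ¬-not (w≢u ∘ neighbour≡support)

  fN-leaf : ∀ f → fN[ G ] f v ≡ f support + f v
  fN-leaf f = trans (sum-supported-at₂ _ support≢leaf outside) (cong₂ _+_ at-support at-leaf)
    where
    outside : ∀ x → x ≢ support → x ≢ v → (if adj G v x ∨ ⌊ x ≟ v ⌋ then f x else 0) ≡ 0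
    outside x x≢u x≢v rewrite non-neighbour x≢u with x ≟ v
    ... | yes x≡v = contradiction x≡v x≢v
    ... | no  _   = refl
    at-support : (if adj G v support ∨ ⌊ support ≟ v ⌋ then f support else 0) ≡ f support
    at-support rewrite support-adj = refl
    at-leaf : (if adj G v v ∨ ⌊ v ≟ v ⌋ then f v else 0) ≡ f v
    at-leaf rewrite irrefl G v with v ≟ v
    ... | yes _   = refl
    ... | no  v≢v = contradiction refl v≢v

  |AN|-leaf : ∀ f → |AN| G f v ≡ [ isPos (f support) ]
  |AN|-leaf f = trans (sum-supported-at _ outside) at-support
    where
    outside : ∀ x → x ≢ support → [ adj G v x ∧ isPos (f x) ] ≡ 0
    outside x x≢u rewrite non-neighbour x≢u = refl
    at-support : [ adj G v support ∧ isPos (f support) ] ≡ [ isPos (f support) ]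
    at-support rewrite support-adj = refl

m≤1+n⇒1+m≤[isPos-m]+1+n : ∀ {m n} → m ≤ suc n → suc m ≤ [ isPos m ] + suc n
m≤1+n⇒1+m≤[isPos-m]+1+n {zero}  _   = s≤s z≤n
m≤1+n⇒1+m≤[isPos-m]+1+n {suc m} m≤n = s≤s m≤n

module Relocation (k : ℕ) {n : ℕ} (G : Graph n) {v : Fin n} (leaf : isLeaf G v) where
  open Leaf G leaf

  relocate : (Fin n → ℕ) → Fin n → ℕ
  relocate f = updateAt (updateAt f v (const 0)) support (const (suc k))

  relocate-leaf : ∀ f → relocate f v ≡ 0
  relocate-leaf f = trans (updateAt-minimal v support _ (support≢leaf ∘ sym)) (updateAt-updates v f)

  relocate-support : ∀ f → relocate f support ≡ suc k
  relocate-support f = updateAt-updates support _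

  relocate-elsewhere : ∀ f {w} → w ≢ v → w ≢ support → relocate f w ≡ f w
  relocate-elsewhere f {w} w≢v w≢u =
    trans (updateAt-minimal w support _ w≢u) (updateAt-minimal w v f w≢v)

  weight-relocate : ∀ f → suc k ≤ f support + f v → weight (relocate f) ≤ weight f
  weight-relocate f k<fu+fv = +-cancelʳ-≤ (f u + f v) _ _ (begin
    weight g + (f u + f v)   ≡⟨ +-assoc (weight g) (f u) (f v) ⟨
    weight g + f u + f v     ≡⟨ cong (λ a → weight g + a + f v) (updateAt-minimal u v f support≢leaf) ⟨
    weight g + f₀ u + f v    ≡⟨ cong (_+ f v) (sum-updateAt f₀ u (const (suc k))) ⟩
    weight f₀ + suc k + f v  ≡⟨ xy∙z≈xz∙y (weight f₀) (suc k) (f v) ⟩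
    weight f₀ + f v + suc k  ≡⟨ cong (_+ suc k) (sum-updateAt f v (const 0)) ⟩
    weight f + 0 + suc k     ≡⟨ cong (_+ suc k) (+-identityʳ (weight f)) ⟩
    weight f + suc k         ≤⟨ +-monoʳ-≤ (weight f) k<fu+fv ⟩
    weight f + (f u + f v)   ∎)
    where
    open ≤-Reasoning
    u : Fin n
    u = support
    f₀ g : Fin n → ℕ
    f₀ = updateAt f v (const 0)
    g = relocate f

  relocate-isKRDF : ∀ {f} → IsKRDF k G f → IsKRDF k G (relocate f)
  relocate-isKRDF {f} (f-bounded , f-cond) = bounded , cond
    where
    g : Fin n → ℕ
    g = relocate f
    bounded : ∀ w → g w ≤ suc k
    bounded w with w ≟ v | w ≟ support
    ... | yes refl | _        = ≤-trans (≤-reflexive (relocate-leaf f)) z≤n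
    ... | no  _    | yes refl = ≤-reflexive (relocate-support f)
    ... | no  w≢v  | no  w≢u  = subst (_≤ suc k) (sym (relocate-elsewhere f w≢v w≢u)) (f-bounded w)
    leaf-condition : k + |AN| G g v ≤ fN[ G ] g v
    leaf-condition rewrite |AN|-leaf g | fN-leaf g | relocate-support f | relocate-leaf f =
      ≤-reflexive (trans (+-comm k 1) (sym (+-identityʳ (suc k))))
    exchange : ∀ {w} → w ≢ support → ∀ x → adj G w x ≡ true →
               [ isPos (g x) ] + f x ≤ [ isPos (f x) ] + g x
    exchange {w} w≢u x wx with x ≟ support
    ... | yes refl = subst (λ a → [ isPos a ] + f support ≤ [ isPos (f support) ] + a)
                           (sym (relocate-support f)) (m≤1+n⇒1+m≤[isPos-m]+1+n (f-bounded support))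
    ... | no  x≢u  = subst (λ a → [ isPos a ] + f x ≤ [ isPos (f x) ] + a)
                           (sym (relocate-elsewhere f x≢v x≢u)) ≤-refl
      where
      x≢v : x ≢ v
      x≢v x≡v = w≢u (adjacent-to-leaf⇒support (subst (λ y → adj G w y ≡ true) x≡v wx))
    cond : ∀ w → g w < k → k + |AN| G g w ≤ fN[ G ] g w
    cond w gw<k with w ≟ v | w ≟ support
    ... | yes refl | _        = leaf-condition
    ... | no  _    | yes refl = contradiction (subst (_< k) (relocate-support f) gw<k) (<-asym (n<1+n k))
    ... | no  w≢v  | no  w≢u  = neighbourhood-exchange G w (≤-reflexive (sym gw≡fw)) (exchange w≢u)
                                  (f-cond w (subst (_< k) gw≡fw gw<k))
      where
      gw≡fw : g w ≡ f w
      gw≡fw = relocate-elsewhere f w≢v w≢u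

  support+leaf-mass : ∀ {f} → IsKRDF k G f → f v ≢ k → suc k ≤ f support + f v
  support+leaf-mass {f} (_ , f-cond) fv≢k with <-cmp (f v) k
  ... | tri≈ _ fv≡k _ = contradiction fv≡k fv≢k
  ... | tri> _ _ k<fv = ≤-trans k<fv (m≤n+m (f v) (f support))
  ... | tri< fv<k _ _ = from-leaf-condition (f support)
    (subst₂ (λ a b → k + a ≤ b) (|AN|-leaf f) (fN-leaf f) (f-cond v fv<k))
    where
    from-leaf-condition : ∀ a → k + [ isPos a ] ≤ a + f v → suc k ≤ a + f v
    from-leaf-condition zero    k≤fv = contradiction fv<k (≤⇒≯ (≤-trans (m≤m+n k 0) k≤fv))
    from-leaf-condition (suc a) k+1≤ = subst (_≤ suc a + f v) (+-comm k 1) k+1≤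

  relocate-γ-function : ∀ {f} → IsGammaKR k G f → f v ≢ k → IsGammaKR k G (relocate f)
  relocate-γ-function {f} (f-krdf , f-min) fv≢k = relocate-isKRDF f-krdf , λ h h-krdf →
    ≤-trans (weight-relocate f (support+leaf-mass f-krdf fv≢k)) (f-min h h-krdf)

proposition2p3 : (k n : ℕ) → 1 ≤ k → 3 ≤ n → (G : Graph n) → Connected G →
    (v : Fin n) → isLeaf G v →
    Σ (Fin n → ℕ) (λ f → IsGammaKR k G f × (f v ≡ 0 ⊎ f v ≡ k))
proposition2p3 k n _ _ G _ v leaf with γ-function-exists k G
... | f , γf with f v ℕ.≟ k
...   | yes fv≡k = f , γf , inj₂ fv≡k
...   | no  fv≢k = relocate f , relocate-γ-function γf fv≢k , inj₁ (relocate-leaf f)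
  where open Relocation k G leaf
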